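{- Let $\mathbf r\in\mathcal R$ and $U_{\mathbf r}(t)=g_1g_2g_3$ with $g_\nu=r_\nu(\sigma_3t+\ell)+1$ ($\nu=1,2,3$). Then for all integers $t\ge0$ and $\nu=1,2,3$ we have $U_{\mathbf r}(t)=P^{h_\nu}_{g_\nu}$ with $h_\nu=2(c_\nu+d_\nu t)$, where $c_\nu=\sigma_1/r_\nu+\ell\sigma_3/r_\nu^2$ and $d_\nu=(\sigma_3/r_\nu)^2$ are positive integers with $c_\nu\ge2$ and $d_\nu\ge4$. In particular $h_\nu\ge4$ if $t=0$ and $h_\nu\ge12$ if $t\ge1$.
   Context: For integers $h\ge1$ and $n\ge1$, the $h$-gonal number is $P^h_n=\frac12\bigl(n^2(h-2)-n(h-4)\bigr)$. $\mathcal R$ is the set of triples $\mathbf r=(r_1,r_2,r_3)$ of pairwise coprime positive integers with $r_1<r_2<r_3$; for such $\mathbf r$, $\sigma_1=r_1+r_2+r_3$, $\sigma_2=r_1r_2+r_1r_3+r_2r_3$, $\sigma_3=r_1r_2r_3$, $\ell$ is the unique integer with $0\le\ell<\sigma_3$ and $\ell\sigma_2\equiv-\sigma_1\pmod{\sigma_3}$, and $U_{\mathbf r}(t)=\prod_{\nu=1}^3(r_\nu(\sigma_3t+\ell)+1)$. -}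

module Defs where

open import Data.Nat using (ℕ; _+_; _*_; _<_)
open import Data.Nat.Coprimality using (Coprime)
open import Data.Product using (_×_)
open import Data.Fin using (Fin; zero; suc)
import Data.Integer as ℤ
open import Data.Integer using (ℤ; +_)
open import Data.Integer.DivMod using (_/ℕ_)

-- h-gonal number P^h_n = (n^2 (h-2) - n (h-4)) / 2, computed in ℤ
-- (the numerator is always even, so the division is exact).
polygonal : ℕ → ℕ → ℤ
polygonal h n =
  ((+ n ℤ.* + n) ℤ.* (+ h ℤ.- + 2) ℤ.- + n ℤ.* (+ h ℤ.- + 4)) /ℕ 2

InR : ℕ → ℕ → ℕ → Set
InR r₁ r₂ r₃ =
  0 < r₁ × r₁ < r₂ × r₂ < r₃ ×
  Coprime r₁ r₂ × Coprime r₁ r₃ × Coprime r₂ r₃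

σ₁ σ₂ σ₃ : ℕ → ℕ → ℕ → ℕ
σ₁ r₁ r₂ r₃ = r₁ + r₂ + r₃
σ₂ r₁ r₂ r₃ = r₁ * r₂ + r₁ * r₃ + r₂ * r₃
σ₃ r₁ r₂ r₃ = r₁ * r₂ * r₃

rAt : ℕ → ℕ → ℕ → Fin 3 → ℕ
rAt r₁ r₂ r₃ zero = r₁
rAt r₁ r₂ r₃ (suc zero) = r₂
rAt r₁ r₂ r₃ (suc (suc zero)) = r₃

g : ℕ → ℕ → ℕ → ℕ → ℕ → Fin 3 → ℕ
g r₁ r₂ r₃ ℓ t ν = rAt r₁ r₂ r₃ ν * (σ₃ r₁ r₂ r₃ * t + ℓ) + 1

U : ℕ → ℕ → ℕ → ℕ → ℕ → ℕ
U r₁ r₂ r₃ ℓ t =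
  g r₁ r₂ r₃ ℓ t zero * g r₁ r₂ r₃ ℓ t (suc zero) * g r₁ r₂ r₃ ℓ t (suc (suc zero))

{-# OPTIONS --safe #-}
-- Fix ν, write r = r_ν, let a, b be the other two entries and X = σ₃ t + ℓ.  By Vieta
-- U = σ₃ X³ + σ₂ X² + σ₁ X + 1 is symmetric in the rᵢ, so r may be moved to the front.
-- Since r ∣ σ₃, the congruence σ₃ ∣ ℓ σ₂ + σ₁ forces r ∣ a + b + ℓ a b =: k r with k ≥ 1,
-- and then (aX + 1)(bX + 1) = rX (k + (ab)² t) + 1.  As P^{2(m+1)}_{n+1} = (n + 1)(nm + 1),
-- this makes U = P^h_{rX+1} with h = 2(c + d t), c = 1 + k = σ₁/r + ℓσ₃/r², d = (ab)² = (σ₃/r)².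
module Submission where

open import Defs
open import Data.Nat using (ℕ; zero; suc; _+_; _*_; _<_; _≤_; _^_; s≤s; z≤n)
open import Data.Nat.Properties using (≤-trans; <⇒≤; m≤m+n; *-monoʳ-≤; *-mono-≤; +-mono-≤; *-assoc)
open import Data.Nat.Divisibility using (_∣_; divides; ∣-trans; ∣m+n∣m⇒∣n; m∣m*n)
open import Data.Nat.DivMod using (m*n/n≡m)
open import Data.Nat.Solver using (module +-*-Solver)
open +-*-Solver using (solve; _:+_; _:*_; _:^_; _:=_; con)
open import Data.Fin using (Fin; zero; suc)
open import Data.Product using (_×_; ∃₂; _,_)
open import Data.Integer using (ℤ; +_)
import Data.Integer as ℤ
open import Data.Integer.Properties using (pos-*)
import Data.Integer.Tactic.RingSolver as ℤ-Solver
open import Relation.Binary.PropositionalEquality using (_≡_; refl; sym; cong; subst; module ≡-Reasoning)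

even-gonal-numerator : ∀ (m x : ℤ) →
  ((x ℤ.+ + 1) ℤ.* (x ℤ.+ + 1)) ℤ.* (+ 2 ℤ.* (+ 1 ℤ.+ m) ℤ.- + 2) ℤ.- (x ℤ.+ + 1) ℤ.* (+ 2 ℤ.* (+ 1 ℤ.+ m) ℤ.- + 4)
    ≡ ((x ℤ.+ + 1) ℤ.* (x ℤ.* m ℤ.+ + 1)) ℤ.* + 2
even-gonal-numerator = ℤ-Solver.solve-∀

polygonal-even : ∀ m n → polygonal (2 * suc m) (n + 1) ≡ + ((n + 1) * (n * m + 1))
polygonal-even m n = begin
  polygonal (2 * suc m) (n + 1)                        ≡⟨ cong (λ h → numerator h ℤ./ℕ 2) (pos-* 2 (suc m)) ⟩
  numerator (+ 2 ℤ.* (+ 1 ℤ.+ + m)) ℤ./ℕ 2             ≡⟨ cong (ℤ._/ℕ 2) (even-gonal-numerator (+ m) (+ n)) ⟩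
  ((+ n ℤ.+ + 1) ℤ.* (+ n ℤ.* + m ℤ.+ + 1)) ℤ.* + 2 ℤ./ℕ 2 ≡⟨ cong (ℤ._/ℕ 2) (sym cast) ⟩
  + (w * 2) ℤ./ℕ 2                                     ≡⟨ cong +_ (m*n/n≡m w 2) ⟩
  + w                                                  ∎
  where
  open ≡-Reasoning
  w : ℕ
  w = (n + 1) * (n * m + 1)
  numerator : ℤ → ℤ
  numerator h = (+ (n + 1) ℤ.* + (n + 1)) ℤ.* (h ℤ.- + 2) ℤ.- + (n + 1) ℤ.* (h ℤ.- + 4)
  cast : + (w * 2) ≡ ((+ n ℤ.+ + 1) ℤ.* (+ n ℤ.* + m ℤ.+ + 1)) ℤ.* + 2
  cast = begin
    + (w * 2)                                  ≡⟨ pos-* w 2 ⟩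
    + w ℤ.* + 2                                ≡⟨ cong (ℤ._* + 2) (pos-* (n + 1) (n * m + 1)) ⟩
    (+ (n + 1) ℤ.* + (n * m + 1)) ℤ.* + 2      ≡⟨ cong (λ y → (+ (n + 1) ℤ.* (y ℤ.+ + 1)) ℤ.* + 2) (pos-* n m) ⟩
    ((+ n ℤ.+ + 1) ℤ.* (+ n ℤ.* + m ℤ.+ + 1)) ℤ.* + 2 ∎

cubic : ℕ → ℕ → ℕ → ℕ → ℕ
cubic S₁ S₂ S₃ X = S₃ * X ^ 3 + S₂ * X ^ 2 + S₁ * X + 1

vieta : ∀ x y z X → (x * X + 1) * (y * X + 1) * (z * X + 1) ≡ cubic (x + y + z) (x * y + x * z + y * z) (x * y * z) X
vieta = solve 4 (λ x y z X → (x :* X :+ con 1) :* (y :* X :+ con 1) :* (z :* X :+ con 1)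
                  := x :* y :* z :* X :^ 3 :+ (x :* y :+ x :* z :+ y :* z) :* X :^ 2 :+ (x :+ y :+ z) :* X :+ con 1) refl

U≡cubic : ∀ x y z ℓ t → U x y z ℓ t ≡ cubic (σ₁ x y z) (σ₂ x y z) (σ₃ x y z) (σ₃ x y z * t + ℓ)
U≡cubic x y z ℓ t = vieta x y z (σ₃ x y z * t + ℓ)

cubic-split : ∀ r a b X →
  cubic (r + a + b) (r * (a + b) + a * b) (r * (a * b)) X ≡ (r * X + 1) * ((a * X + 1) * (b * X + 1))
cubic-split = solve 4 (λ r a b X → r :* (a :* b) :* X :^ 3 :+ (r :* (a :+ b) :+ a :* b) :* X :^ 2 :+ (r :+ a :+ b) :* X :+ con 1
                        := (r :* X :+ con 1) :* ((a :* X :+ con 1) :* (b :* X :+ con 1))) refl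

cofactor-product : ∀ r a b ℓ t k → a + b + ℓ * (a * b) ≡ k * r →
  (a * (r * (a * b) * t + ℓ) + 1) * (b * (r * (a * b) * t + ℓ) + 1)
    ≡ r * (r * (a * b) * t + ℓ) * (k + (a * b) ^ 2 * t) + 1
cofactor-product r a b ℓ t k eq = begin
  (a * X + 1) * (b * X + 1)
    ≡⟨ solve 5 (λ r a b ℓ t → let X = r :* (a :* b) :* t :+ ℓ in
         (a :* X :+ con 1) :* (b :* X :+ con 1) := X :* (a :+ b :+ ℓ :* (a :* b)) :+ r :* X :* ((a :* b) :^ 2 :* t) :+ con 1)
         refl r a b ℓ t ⟩
  X * (a + b + ℓ * (a * b)) + r * X * ((a * b) ^ 2 * t) + 1
    ≡⟨ cong (λ s → X * s + r * X * ((a * b) ^ 2 * t) + 1) eq ⟩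
  X * (k * r) + r * X * ((a * b) ^ 2 * t) + 1
    ≡⟨ solve 6 (λ r a b ℓ t k → let X = r :* (a :* b) :* t :+ ℓ in
         X :* (k :* r) :+ r :* X :* ((a :* b) :^ 2 :* t) :+ con 1 := r :* X :* (k :+ (a :* b) :^ 2 :* t) :+ con 1)
         refl r a b ℓ t k ⟩
  r * X * (k + (a * b) ^ 2 * t) + 1
    ∎
  where
  open ≡-Reasoning
  X : ℕ
  X = r * (a * b) * t + ℓ

root-divides-cofactor : ∀ r a b ℓ →
  r * (a * b) ∣ ℓ * (r * (a + b) + a * b) + (r + a + b) → r ∣ a + b + ℓ * (a * b)
root-divides-cofactor r a b ℓ σ₃∣ = ∣m+n∣m⇒∣n r∣sum (m∣m*n (ℓ * (a + b) + 1))
  where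
  regroup : ℓ * (r * (a + b) + a * b) + (r + a + b) ≡ r * (ℓ * (a + b) + 1) + (a + b + ℓ * (a * b))
  regroup = solve 4 (λ r a b ℓ → ℓ :* (r :* (a :+ b) :+ a :* b) :+ (r :+ a :+ b)
                                 := r :* (ℓ :* (a :+ b) :+ con 1) :+ (a :+ b :+ ℓ :* (a :* b))) refl r a b ℓ
  r∣sum : r ∣ r * (ℓ * (a + b) + 1) + (a + b + ℓ * (a * b))
  r∣sum = subst (r ∣_) regroup (∣-trans (m∣m*n (a * b)) σ₃∣)

gonality-bounds : ∀ {c d} → 2 ≤ c → 4 ≤ d → ∀ t →
  (t ≡ 0 → 4 ≤ 2 * (c + d * t)) × (1 ≤ t → 12 ≤ 2 * (c + d * t))
gonality-bounds {c} {d} 2≤c 4≤d t =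
  (λ _ → *-monoʳ-≤ 2 (≤-trans 2≤c (m≤m+n c (d * t)))) ,
  (λ 1≤t → *-monoʳ-≤ 2 (+-mono-≤ 2≤c (*-mono-≤ 4≤d 1≤t)))

PolygonalRepresentation : (r S₁ S₃ ℓ t u : ℕ) → Set
PolygonalRepresentation r S₁ S₃ ℓ t u = ∃₂ λ (c d : ℕ) →
  c * r ^ 2 ≡ S₁ * r + ℓ * S₃ ×
  d * r ^ 2 ≡ S₃ ^ 2 ×
  2 ≤ c × 4 ≤ d ×
  + u ≡ polygonal (2 * (c + d * t)) (r * (S₃ * t + ℓ) + 1) ×
  (t ≡ 0 → 4 ≤ 2 * (c + d * t)) ×
  (1 ≤ t → 12 ≤ 2 * (c + d * t))

polygonal-representation : ∀ {r a b S₁ S₂ S₃} → 1 ≤ a → 2 ≤ b →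
  S₁ ≡ r + a + b → S₂ ≡ r * (a + b) + a * b → S₃ ≡ r * (a * b) →
  ∀ ℓ t → S₃ ∣ ℓ * S₂ + S₁ → PolygonalRepresentation r S₁ S₃ ℓ t (cubic S₁ S₂ S₃ (S₃ * t + ℓ))
polygonal-representation {r} {a} {b} 1≤a@(s≤s _) 2≤b refl refl refl ℓ t σ₃∣
  with root-divides-cofactor r a b ℓ σ₃∣
... | divides zero ()
... | divides (suc k) eq =
  suc (suc k) , d , c-eq , d-eq , s≤s (s≤s z≤n) , 4≤d , representation , gonality-bounds (s≤s (s≤s z≤n)) 4≤d t
  where
  open ≡-Reasoning
  X d : ℕ
  X = r * (a * b) * t + ℓ
  d = (a * b) ^ 2
  4≤d : 4 ≤ d
  4≤d = *-mono-≤ 2≤ab (*-mono-≤ 2≤ab (s≤s z≤n))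
    where
    2≤ab : 2 ≤ a * b
    2≤ab = *-mono-≤ 1≤a 2≤b
  c-eq : suc (suc k) * r ^ 2 ≡ (r + a + b) * r + ℓ * (r * (a * b))
  c-eq = begin
    suc (suc k) * r ^ 2                     ≡⟨ solve 2 (λ k r → (con 1 :+ k) :* r :^ 2 := r :* r :+ (k :* r) :* r) refl (suc k) r ⟩
    r * r + suc k * r * r                   ≡⟨ cong (λ s → r * r + s * r) (sym eq) ⟩
    r * r + (a + b + ℓ * (a * b)) * r       ≡⟨ solve 4 (λ r a b ℓ → r :* r :+ (a :+ b :+ ℓ :* (a :* b)) :* r
                                                         := (r :+ a :+ b) :* r :+ ℓ :* (r :* (a :* b))) refl r a b ℓ ⟩
    (r + a + b) * r + ℓ * (r * (a * b))     ∎
  d-eq : d * r ^ 2 ≡ (r * (a * b)) ^ 2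
  d-eq = solve 3 (λ r a b → (a :* b) :^ 2 :* r :^ 2 := (r :* (a :* b)) :^ 2) refl r a b
  representation : + cubic (r + a + b) (r * (a + b) + a * b) (r * (a * b)) X
                   ≡ polygonal (2 * (suc (suc k) + d * t)) (r * X + 1)
  representation = begin
    + cubic (r + a + b) (r * (a + b) + a * b) (r * (a * b)) X
      ≡⟨ cong +_ (cubic-split r a b X) ⟩
    + ((r * X + 1) * ((a * X + 1) * (b * X + 1)))
      ≡⟨ cong (λ v → + ((r * X + 1) * v)) (cofactor-product r a b ℓ t (suc k) eq) ⟩
    + ((r * X + 1) * (r * X * (suc k + d * t) + 1))
      ≡⟨ sym (polygonal-even (suc k + d * t) (r * X)) ⟩
    polygonal (2 * (suc (suc k) + d * t)) (r * X + 1)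
      ∎

other-two : ∀ {x y z} → InR x y z → ∀ ν → ∃₂ λ a b → 1 ≤ a × 2 ≤ b ×
  σ₁ x y z ≡ rAt x y z ν + a + b ×
  σ₂ x y z ≡ rAt x y z ν * (a + b) + a * b ×
  σ₃ x y z ≡ rAt x y z ν * (a * b)
other-two {x} {y} {z} (0<x , x<y , y<z , _) zero =
  y , z , ≤-trans 0<x (<⇒≤ x<y) , ≤-trans (≤-trans (s≤s 0<x) x<y) (<⇒≤ y<z) , refl ,
  solve 3 (λ x y z → x :* y :+ x :* z :+ y :* z := x :* (y :+ z) :+ y :* z) refl x y z ,
  *-assoc x y z
other-two {x} {y} {z} (0<x , x<y , y<z , _) (suc zero) =
  x , z , 0<x , ≤-trans (≤-trans (s≤s 0<x) x<y) (<⇒≤ y<z) ,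
  solve 3 (λ x y z → x :+ y :+ z := y :+ x :+ z) refl x y z ,
  solve 3 (λ x y z → x :* y :+ x :* z :+ y :* z := y :* (x :+ z) :+ x :* z) refl x y z ,
  solve 3 (λ x y z → x :* y :* z := y :* (x :* z)) refl x y z
other-two {x} {y} {z} (0<x , x<y , _) (suc (suc zero)) =
  x , y , 0<x , ≤-trans (s≤s 0<x) x<y ,
  solve 3 (λ x y z → x :+ y :+ z := z :+ x :+ y) refl x y z ,
  solve 3 (λ x y z → x :* y :+ x :* z :+ y :* z := z :* (x :+ y) :+ x :* y) refl x y z ,
  solve 3 (λ x y z → x :* y :* z := z :* (x :* y)) refl x y z

-- ℓ < σ₃ and the coprimality of the rᵢ only serve to make ℓ exist and be unique.
theorem10p1 : (r₁ r₂ r₃ : ℕ) → InR r₁ r₂ r₃ →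
    (ℓ : ℕ) → ℓ < σ₃ r₁ r₂ r₃ → σ₃ r₁ r₂ r₃ ∣ ℓ * σ₂ r₁ r₂ r₃ + σ₁ r₁ r₂ r₃ →
    (t : ℕ) (ν : Fin 3) →
    ∃₂ λ (c d : ℕ) →
      c * rAt r₁ r₂ r₃ ν ^ 2 ≡ σ₁ r₁ r₂ r₃ * rAt r₁ r₂ r₃ ν + ℓ * σ₃ r₁ r₂ r₃ ×
      d * rAt r₁ r₂ r₃ ν ^ 2 ≡ σ₃ r₁ r₂ r₃ ^ 2 ×
      2 ≤ c × 4 ≤ d ×
      + U r₁ r₂ r₃ ℓ t ≡ polygonal (2 * (c + d * t)) (g r₁ r₂ r₃ ℓ t ν) ×
      (t ≡ 0 → 4 ≤ 2 * (c + d * t)) ×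
      (1 ≤ t → 12 ≤ 2 * (c + d * t))
theorem10p1 r₁ r₂ r₃ r∈ℛ ℓ _ σ₃∣ t ν with other-two r∈ℛ ν
... | a , b , 1≤a , 2≤b , σ₁≡ , σ₂≡ , σ₃≡ =
  subst (PolygonalRepresentation (rAt r₁ r₂ r₃ ν) (σ₁ r₁ r₂ r₃) (σ₃ r₁ r₂ r₃) ℓ t)
        (sym (U≡cubic r₁ r₂ r₃ ℓ t))
        (polygonal-representation 1≤a 2≤b σ₁≡ σ₂≡ σ₃≡ ℓ t σ₃∣)
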